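{- Let $W$ be a condensed wall. Then $W-\{a,b\}$ contains no subgraph isomorphic to a subdivision of the elementary $B_4$.
   Context: Condensed wall $W$ of size $r$: vertices $u^j_1,\dots,u^j_{2r}$ ($j\in[r]$), $z_0,\dots,z_r$, $a$, $b$; edges $u^j_ku^j_{k+1}$ ($k<2r$), and for all $i,j\in[r]$ the edges $z_{j-1}u^j_{2i-1}$, $z_ju^j_{2i}$, $au^j_1$, $bu^j_{2r}$, and $z_{i-1}z_i$. In the hexagonal tiling of the plane call the hexagonal faces cells, two cells being adjacent if they share an edge. The elementary $B_4$ is the union of the boundary $6$-cycles of two adjacent cells $X,Y$ together with the two cells that are adjacent to both $X$ and $Y$. -}

module Defs where

open import Data.Nat using (ℕ; zero; suc; _*_)
open import Data.Nat.DivMod using (_%_)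
open import Data.Fin using (Fin; toℕ; zero; suc; #_)
open import Data.Bool using (Bool; true; false; T)
open import Data.Product using (Σ; _×_; _,_; proj₁)
open import Data.Sum using (_⊎_)
open import Data.List using (List; []; _∷_; _++_; [_])
open import Data.List.Membership.Propositional using (_∈_)
open import Data.List.Relation.Unary.Unique.Propositional using (Unique)
open import Data.Vec using (Vec; lookup) renaming ([] to []ᵥ; _∷_ to _∷ᵥ_)
open import Data.Empty using (⊥)
open import Data.Unit using (⊤)
open import Relation.Nullary using (¬_)
open import Relation.Binary.PropositionalEquality using (_≡_; _≢_)

record Graph : Set₁ where
  field
    V : Set
    E : V → V → Set
open Graph public

IsWalk : (G : Graph) → List (V G) → Set
IsWalk G []           = ⊤
IsWalk G (x ∷ [])     = ⊤
IsWalk G (x ∷ y ∷ xs) = E G x y × IsWalk G (y ∷ xs)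

-- "G contains a subgraph isomorphic to a subdivision of H".
-- Such a subgraph consists of pairwise distinct branch vertices
-- (images of V H) and, for each edge xy of H, a path in G from the
-- branch vertex of x to that of y, these paths having pairwise
-- distinct internal vertices (Unique), internal vertices that are not
-- branch vertices, and paths of distinct edges {x,y} ≠ {x',y'} being
-- internally disjoint.  'inner x y' lists the internal vertices of
-- the path subdividing the edge xy (only used when xy is an edge).

SameEdge : {A : Set} → A → A → A → A → Set
SameEdge x y x' y' = (x ≡ x' × y ≡ y') ⊎ (x ≡ y' × y ≡ x')

record SubdivisionIn (H G : Graph) : Set where
  field
    branch        : V H → V G
    branch-inj    : ∀ x y → branch x ≡ branch y → x ≡ y
    inner         : V H → V H → List (V G)
    inner-walk    : ∀ x y → E H x y →
                    IsWalk G (branch x ∷ inner x y ++ [ branch y ])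
    inner-unique  : ∀ x y → E H x y → Unique (inner x y)
    inner-nobranch : ∀ x y → E H x y → ∀ v → v ∈ inner x y →
                     ∀ w → v ≢ branch w
    inner-disjoint : ∀ x y x' y' → E H x y → E H x' y' →
                     ¬ SameEdge x y x' y' →
                     ∀ v → v ∈ inner x y → v ∈ inner x' y' → ⊥

-- The elementary B₄: union of the boundary 6-cycles of four cells of
-- the hexagonal tiling: two adjacent cells X, Y and the two cells
-- Z₁, Z₂ adjacent to both.  Vertex labelling (Fin 16):
--   X  = 0-1-2-3-4-5        (cyclic)
--   Y  = 0-1-6-7-8-9        (shares edge 0-1 with X)
--   Z₁ = 2-1-6-10-11-12     (the third cell at vertex 1)
--   Z₂ = 5-0-9-13-14-15     (the third cell at vertex 0)

cell : Fin 4 → Vec (Fin 16) 6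
cell zero = # 0 ∷ᵥ # 1 ∷ᵥ # 2 ∷ᵥ # 3 ∷ᵥ # 4 ∷ᵥ # 5 ∷ᵥ []ᵥ
cell (suc zero) = # 0 ∷ᵥ # 1 ∷ᵥ # 6 ∷ᵥ # 7 ∷ᵥ # 8 ∷ᵥ # 9 ∷ᵥ []ᵥ
cell (suc (suc zero)) = # 2 ∷ᵥ # 1 ∷ᵥ # 6 ∷ᵥ # 10 ∷ᵥ # 11 ∷ᵥ # 12 ∷ᵥ []ᵥ
cell (suc (suc (suc zero))) = # 5 ∷ᵥ # 0 ∷ᵥ # 9 ∷ᵥ # 13 ∷ᵥ # 14 ∷ᵥ # 15 ∷ᵥ []ᵥ

next6 : Fin 6 → Fin 6
next6 zero = # 1
next6 (suc zero) = # 2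
next6 (suc (suc zero)) = # 3
next6 (suc (suc (suc zero))) = # 4
next6 (suc (suc (suc (suc zero)))) = # 5
next6 (suc (suc (suc (suc (suc zero))))) = # 0

B4Adj : Fin 16 → Fin 16 → Set
B4Adj x y = Σ (Fin 4) λ c → Σ (Fin 6) λ i →
  SameEdge (lookup (cell c) i) (lookup (cell c) (next6 i)) x y

B4 : Graph
B4 = record { V = Fin 16 ; E = B4Adj }

-- Indices are 0-based:
--   u j k  (j : Fin r, k : Fin (2r))  is  u^{j+1}_{k+1},
--   z i    (i : Fin (r+1))            is  z_i.
-- Edge list (0-based translation of the paper's):
--   u^j_k u^j_{k+1}                 ↦ u j k — u j k'   with k' = k+1
--   z_{j-1} u^j_{2i-1} (i ∈ [r])    ↦ z i — u j k      with i = j, k even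
--   z_j u^j_{2i} (i ∈ [r])          ↦ z i — u j k      with i = j+1, k odd
--   a u^j_1                         ↦ a — u j k        with k = 0
--   b u^j_{2r}                      ↦ b — u j k        with k+1 = 2r
--   z_{i-1} z_i                     ↦ z i — z i'       with i' = i+1

data WV (r : ℕ) : Set where
  u : Fin r → Fin (2 * r) → WV r
  z : Fin (suc r) → WV r
  a : WV r
  b : WV r

data WEdge (r : ℕ) : WV r → WV r → Set where
  uu  : ∀ j k k' → toℕ k' ≡ suc (toℕ k) → WEdge r (u j k) (u j k')
  zuo : ∀ i j k → toℕ i ≡ toℕ j → toℕ k % 2 ≡ 0 → WEdge r (z i) (u j k)
  zue : ∀ i j k → toℕ i ≡ suc (toℕ j) → toℕ k % 2 ≡ 1 → WEdge r (z i) (u j k)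
  au  : ∀ j k → toℕ k ≡ 0 → WEdge r a (u j k)
  bu  : ∀ j k → suc (toℕ k) ≡ 2 * r → WEdge r b (u j k)
  zz  : ∀ i i' → toℕ i' ≡ suc (toℕ i) → WEdge r (z i) (z i')

WAdj : (r : ℕ) → WV r → WV r → Set
WAdj r x y = WEdge r x y ⊎ WEdge r y x

W : ℕ → Graph
W r = record { V = WV r ; E = WAdj r }

notAB : {r : ℕ} → WV r → Bool
notAB a = false
notAB b = false
notAB _ = true

W-ab : ℕ → Graph
W-ab r = record { V = Σ (WV r) (λ v → T (notAB v))
                ; E = λ x y → WAdj r (proj₁ x) (proj₁ y) }

-- Give z_i the height 2i and the row u^{j+1} the height 2j+1.  No edge of W − {a, b} jumps
-- over an even height and z_m is the only vertex of height 2m, so z_m is a cut vertex: no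
-- cycle has vertices strictly on both sides of it, and two cycles sharing two vertices
-- cannot lie strictly on opposite sides either.  The cells X, Y and the outer boundary O of
-- B₄ pairwise share two branch vertices, so the indices of the z-vertices on their images
-- differ pairwise by at most one: there are at most two such z-vertices.
--
-- Away from the z-vertices W − {a, b} is a disjoint union of paths (the rows).  Hence a
-- branch vertex of degree three is a z-vertex or has one among its three neighbours, and
-- every cycle with three vertices passes through a z-vertex.  The z-vertices found in this
-- way around the branch vertices 2 and 6 must coincide, and the only vertex their
-- neighbourhoods share is the branch vertex 1; likewise around 5 and 9 the branch vertex 0 is
-- a z-vertex.  But O avoids 0 and 1 and passes through a third z-vertex.

module Submission where

open import Defs
open import Data.Nat using (ℕ; suc; _+_; _*_; _<_; _≤_; s≤s; _≟_; _≤?_)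
open import Data.Nat.Properties
  using ( <-cmp; <-asym; <-trans; <-≤-trans; n<1+n; <⇒≢; <⇒≱; ≰⇒>; m<1+n⇒m≤n
        ; suc-injective; +-suc; *-suc; *-monoʳ-<; *-cancelˡ-<; *-cancelˡ-≡; even≢odd )
open import Data.Fin using (Fin; zero; suc; toℕ; combine; #_)
open import Data.Fin.Properties
  using (toℕ-injective; toℕ-combine; combine-injectiveˡ; combine-injectiveʳ)
import Data.Fin.Properties as Finₚ
open import Data.Vec using (lookup)
open import Data.Product using (∃₂; ∃-syntax; _×_; _,_; proj₁; proj₂)
open import Data.Sum as Sum using (_⊎_; inj₁; inj₂; [_,_]′)
open import Data.Empty using (⊥; ⊥-elim)
open import Data.Unit using (⊤; tt)
open import Data.List using (List; []; _∷_; _++_; [_]; initLast; _∷ʳ′_)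
open import Data.List.Properties using (++-assoc; ++-identityʳ)
open import Data.List.Membership.Propositional using (_∈_; _∉_; find)
open import Data.List.Membership.Propositional.Properties using (∈-∃++; ∈-++⁺ˡ; ∈-++⁺ʳ; ∈-++⁻)
import Data.List.Membership.DecPropositional as DecMembership
open import Data.List.Relation.Unary.Any using (here; there; any?)
open import Data.List.Relation.Unary.Any.Properties using (singleton⁻)
open import Data.List.Relation.Unary.All as All using (All; []; _∷_)
open import Data.List.Relation.Unary.All.Properties using (¬Any⇒All¬)
open import Data.List.Relation.Unary.AllPairs using (AllPairs; []; _∷_; allPairs?)
open import Data.List.Relation.Unary.Unique.Propositional using (Unique)
open import Data.List.Relation.Unary.Unique.Propositional.Properties
  using (Unique[x∷xs]⇒x∉xs; drop⁺; ++⁺)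
open import Data.List.Relation.Binary.Subset.Propositional using (_⊆_)
open import Data.List.Relation.Binary.Subset.Propositional.Properties using (xs⊆xs++ys; xs⊆ys++xs)
open import Data.List.Relation.Binary.Permutation.Propositional using (_↭_; ↭⇒↭ₛ)
open import Data.List.Relation.Binary.Permutation.Propositional.Properties using (∈-resp-↭; ++-comm)
import Data.List.Relation.Binary.Permutation.Setoid.Properties as PermutationSetoid
open import Function using (id; _∘_; case_of_)
open import Relation.Nullary using (¬_; Dec; yes; no; ¬?)
open import Relation.Nullary.Decidable using (_×-dec_; _⊎-dec_; map′; from-yes)
open import Relation.Binary using (tri<; tri≈; tri>)
open import Relation.Binary.Definitions using (DecidableEquality)
open import Relation.Binary.PropositionalEquality
  using (_≡_; _≢_; refl; sym; trans; cong; cong₂; subst; setoid; module ≡-Reasoning)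

-- Lists and walks

module _ {A : Set} where

  unique-resp-↭ : {xs ys : List A} → xs ↭ ys → Unique xs → Unique ys
  unique-resp-↭ p = PermutationSetoid.Unique-resp-↭ (setoid A) (↭⇒↭ₛ p)

  headOr : List A → A → A
  headOr []      d = d
  headOr (x ∷ _) _ = x

  lastOr : List A → A → A
  lastOr []       d = d
  lastOr (x ∷ xs) _ = lastOr xs x

  headOr-∈ : ∀ xs {d} → headOr xs d ∈ xs ++ [ d ]
  headOr-∈ []      = here refl
  headOr-∈ (_ ∷ _) = here refl

  lastOr-∈ : ∀ xs {d} → lastOr xs d ∈ d ∷ xs
  lastOr-∈ []       = here refl
  lastOr-∈ (_ ∷ xs) = there (lastOr-∈ xs)

module _ {G : Graph} where

  isWalk-∷⁻ : ∀ {x} xs → IsWalk G (x ∷ xs) → IsWalk G xs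
  isWalk-∷⁻ []      _       = tt
  isWalk-∷⁻ (_ ∷ _) (_ , w) = w

  isWalk-++⁻ˡ : ∀ xs {ys} → IsWalk G (xs ++ ys) → IsWalk G xs
  isWalk-++⁻ˡ []           _       = tt
  isWalk-++⁻ˡ (_ ∷ [])     _       = tt
  isWalk-++⁻ˡ (_ ∷ y ∷ xs) (e , w) = e , isWalk-++⁻ˡ (y ∷ xs) w

  isWalk-++⁻ʳ : ∀ xs {ys} → IsWalk G (xs ++ ys) → IsWalk G ys
  isWalk-++⁻ʳ []       w = w
  isWalk-++⁻ʳ (_ ∷ xs) w = isWalk-++⁻ʳ xs (isWalk-∷⁻ (xs ++ _) w)

  isWalk-++⁺ : ∀ xs {y ys} → IsWalk G (xs ++ [ y ]) → IsWalk G (y ∷ ys) →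
               IsWalk G (xs ++ y ∷ ys)
  isWalk-++⁺ []           _        w = w
  isWalk-++⁺ (_ ∷ [])     (e , _)  w = e , w
  isWalk-++⁺ (_ ∷ x ∷ xs) (e , w′) w = e , isWalk-++⁺ (x ∷ xs) w′ w

  isWalk-first-edge : ∀ {p} xs {q} → IsWalk G (p ∷ xs ++ [ q ]) → E G p (headOr xs q)
  isWalk-first-edge []      (e , _) = e
  isWalk-first-edge (_ ∷ _) (e , _) = e

  isWalk-last-edge : ∀ {p} xs {q} → IsWalk G (p ∷ xs ++ [ q ]) → E G (lastOr xs p) q
  isWalk-last-edge []       (e , _) = e
  isWalk-last-edge (_ ∷ xs) (_ , w) = isWalk-last-edge xs w

record Cycle (G : Graph) : Set where
  field
    start    : V G
    rest     : List (V G)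
    closed   : IsWalk G (start ∷ rest ++ [ start ])
    distinct : Unique (start ∷ rest)

  vertices : List (V G)
  vertices = start ∷ rest

open Cycle public

Linked : {G : Graph} → Cycle G → Cycle G → Set
Linked {G} C D = ∃₂ λ (s t : V G) → s ≢ t ×
  (s ∈ vertices C × s ∈ vertices D) × (t ∈ vertices C × t ∈ vertices D)

cycle-delete-vertex : ∀ {G} (C : Cycle G) {y} → y ∈ vertices C →
                      ∃[ P ] IsWalk G P × vertices C ↭ y ∷ P
cycle-delete-vertex C y∈C with ∈-∃++ y∈C
cycle-delete-vertex record { closed = w } _ | [] , P , refl =
  P , isWalk-++⁻ˡ P (isWalk-∷⁻ (P ++ _) w) , _↭_.refl
cycle-delete-vertex {G} record { start = s ; closed = w } _ | (.s ∷ X) , Y , refl =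
  Y ++ s ∷ X , isWalk-++⁺ Y Y-then-s s-then-X , ++-comm (s ∷ X) (_ ∷ Y)
  where
  w′ : IsWalk G ((s ∷ X) ++ _ ∷ (Y ++ [ s ]))
  w′ = subst (λ l → IsWalk G (s ∷ l)) (++-assoc X (_ ∷ Y) [ s ]) w
  s-then-X : IsWalk G (s ∷ X)
  s-then-X = isWalk-++⁻ˡ (s ∷ X) w′
  Y-then-s : IsWalk G (Y ++ [ s ])
  Y-then-s = isWalk-∷⁻ (Y ++ [ s ]) (isWalk-++⁻ʳ (s ∷ X) w′)

-- Heights

Crosses : ℕ → ℕ → ℕ → Set
Crosses n p q = (p < n × n < q) ⊎ (q < n × n < p)

Adjacent : ℕ → ℕ → Set
Adjacent p q = suc p ≡ q ⊎ suc q ≡ p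

¬between-successive : ∀ {p n} → p < n → n < suc p → ⊥
¬between-successive p<n n<1+p = <⇒≱ p<n (m<1+n⇒m≤n n<1+p)

adjacent⇒¬crosses : ∀ {n p q} → Adjacent p q → ¬ Crosses n p q
adjacent⇒¬crosses (inj₁ refl) (inj₁ (p<n , n<q)) = ¬between-successive p<n n<q
adjacent⇒¬crosses (inj₁ refl) (inj₂ (q<n , n<p)) = <-asym n<p (<-trans (n<1+n _) q<n)
adjacent⇒¬crosses (inj₂ refl) (inj₁ (p<n , n<q)) = <-asym n<q (<-trans (n<1+n _) p<n)
adjacent⇒¬crosses (inj₂ refl) (inj₂ (q<n , n<p)) = ¬between-successive q<n n<p

adjacent-below : ∀ {p q} → Adjacent p q → q < p → suc q ≡ p
adjacent-below (inj₁ refl) q<p = ⊥-elim (<-asym q<p (n<1+n _))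
adjacent-below (inj₂ e)    _   = e

adjacent-above : ∀ {p q} → Adjacent p q → p < q → suc p ≡ q
adjacent-above (inj₁ e)    _   = e
adjacent-above (inj₂ refl) p<q = ⊥-elim (<-asym p<q (n<1+n _))

adjacent-pigeonhole : ∀ {p q₁ q₂ q₃} → Adjacent p q₁ → Adjacent p q₂ → Adjacent p q₃ →
                      q₁ ≡ q₂ ⊎ q₁ ≡ q₃ ⊎ q₂ ≡ q₃
adjacent-pigeonhole (inj₁ refl) (inj₁ refl) _           = inj₁ refl
adjacent-pigeonhole (inj₂ refl) (inj₂ refl) _           = inj₁ refl
adjacent-pigeonhole (inj₁ refl) (inj₂ _)    (inj₁ refl) = inj₂ (inj₁ refl)
adjacent-pigeonhole (inj₂ refl) (inj₁ _)    (inj₂ refl) = inj₂ (inj₁ refl)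
adjacent-pigeonhole (inj₁ _)    (inj₂ refl) (inj₂ refl) = inj₂ (inj₂ refl)
adjacent-pigeonhole (inj₂ _)    (inj₁ refl) (inj₁ refl) = inj₂ (inj₂ refl)

m<n<o⇒o≰1+m : ∀ {m n o} → m < n → n < o → ¬ o ≤ suc m
m<n<o⇒o≰1+m m<n n<o = <⇒≱ (<-≤-trans (s≤s m<n) n<o)

within-one-pigeonhole : ∀ {i j k} → j ≤ suc i → i ≤ suc j → k ≤ suc j → j ≤ suc k →
                        k ≤ suc i → i ≤ suc k → i ≡ j ⊎ j ≡ k ⊎ i ≡ k
within-one-pigeonhole {i} {j} {k} j≤i i≤j k≤j j≤k k≤i i≤k
  with <-cmp i j | <-cmp j k | <-cmp i k
... | tri≈ _ i≡j _ | _            | _            = inj₁ i≡j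
... | _            | tri≈ _ j≡k _ | _            = inj₂ (inj₁ j≡k)
... | _            | _            | tri≈ _ i≡k _ = inj₂ (inj₂ i≡k)
... | tri< i<j _ _ | tri< j<k _ _ | _            = ⊥-elim (m<n<o⇒o≰1+m i<j j<k k≤i)
... | tri< _ _ _   | tri> _ _ k<j | tri< i<k _ _ = ⊥-elim (m<n<o⇒o≰1+m i<k k<j j≤i)
... | tri< i<j _ _ | tri> _ _ _   | tri> _ _ k<i = ⊥-elim (m<n<o⇒o≰1+m k<i i<j j≤k)
... | tri> _ _ j<i | tri< _ _ _   | tri< i<k _ _ = ⊥-elim (m<n<o⇒o≰1+m j<i i<k k≤j)
... | tri> _ _ _   | tri< j<k _ _ | tri> _ _ k<i = ⊥-elim (m<n<o⇒o≰1+m j<k k<i i≤j)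
... | tri> _ _ j<i | tri> _ _ k<j | _            = ⊥-elim (m<n<o⇒o≰1+m k<j j<i i≤k)

module _ {G : Graph} (Q : V G → Set) (h : V G → ℕ) (n : ℕ)
         (no-crossing : ∀ {x y} → Q x → Q y → E G x y → ¬ Crosses n (h x) (h y)) where

  walk-on-one-side : ∀ {xs} → IsWalk G xs → All Q xs → All (λ x → h x ≢ n) xs →
                     All (λ x → h x < n) xs ⊎ All (λ x → n < h x) xs
  walk-on-one-side {[]}     _ _ _ = inj₁ []
  walk-on-one-side {x ∷ []} _ _ (x≢n ∷ []) with <-cmp (h x) n
  ... | tri< x<n _   _   = inj₁ (x<n ∷ [])
  ... | tri≈ _   x≡n _   = ⊥-elim (x≢n x≡n)
  ... | tri> _   _   n<x = inj₂ (n<x ∷ [])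
  walk-on-one-side {x ∷ _ ∷ _} (e , w) (qx ∷ qs@(qy ∷ _)) (x≢n ∷ ns)
    with walk-on-one-side w qs ns | <-cmp (h x) n
  ... | _              | tri≈ _ x≡n _ = ⊥-elim (x≢n x≡n)
  ... | inj₁ below     | tri< x<n _ _ = inj₁ (x<n ∷ below)
  ... | inj₂ above     | tri> _ _ n<x = inj₂ (n<x ∷ above)
  ... | inj₁ (y<n ∷ _) | tri> _ _ n<x = ⊥-elim (no-crossing qx qy e (inj₂ (y<n , n<x)))
  ... | inj₂ (n<y ∷ _) | tri< x<n _ _ = ⊥-elim (no-crossing qx qy e (inj₁ (x<n , n<y)))

  walk-not-across : ∀ {xs x y} → IsWalk G xs → All Q xs → All (λ x → h x ≢ n) xs →
                    x ∈ xs → y ∈ xs → h x < n → n < h y → ⊥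
  walk-not-across w qs ns x∈ y∈ x<n n<y with walk-on-one-side w qs ns
  ... | inj₁ below = <-asym n<y (All.lookup below y∈)
  ... | inj₂ above = <-asym x<n (All.lookup above x∈)

module _ {G : Graph} (h : V G → ℕ) (n : ℕ)
         (no-crossing : ∀ {x y} → E G x y → ¬ Crosses n (h x) (h y))
         (level-unique : ∀ {x y} → h x ≡ n → h y ≡ n → x ≡ y) where

  cycle-not-across : (C : Cycle G) → ∀ {x y} → x ∈ vertices C → y ∈ vertices C →
                     h x < n → n < h y → ⊥
  cycle-not-across C x∈ y∈ x<n n<y with any? (λ v → h v ≟ n) (vertices C)
  ... | no none =
    walk-not-across (λ _ → ⊤) h n (λ _ _ → no-crossing)
      (isWalk-++⁻ˡ (vertices C) (closed C)) (All.universal _ _) (¬Any⇒All¬ _ none)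
      x∈ y∈ x<n n<y
  ... | yes some with find some
  ...   | c , c∈ , c-level with cycle-delete-vertex C c∈
  ...     | P , P-walk , C↭cP =
    walk-not-across (λ _ → ⊤) h n (λ _ _ → no-crossing)
      P-walk (All.universal _ _) (All.tabulate off-level)
      (in-P x∈ (<⇒≢ x<n)) (in-P y∈ (<⇒≢ n<y ∘ sym)) x<n n<y
    where
    c∉P : c ∉ P
    c∉P = Unique[x∷xs]⇒x∉xs (unique-resp-↭ C↭cP (distinct C))
    off-level : ∀ {v} → v ∈ P → h v ≢ n
    off-level v∈P v-level with level-unique v-level c-level
    ... | refl = c∉P v∈P
    in-P : ∀ {v} → v ∈ vertices C → h v ≢ n → v ∈ P
    in-P v∈ v≢n with ∈-resp-↭ C↭cP v∈
    ... | here refl = ⊥-elim (v≢n c-level)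
    ... | there v∈P = v∈P

  linked-not-across : (C D : Cycle G) → Linked C D → ∀ {x y} →
                      x ∈ vertices C → y ∈ vertices D → h x < n → n < h y → ⊥
  linked-not-across C D (s , t , s≢t , (s∈C , s∈D) , (t∈C , t∈D)) x∈C y∈D x<n n<y =
    s≢t (level-unique (on-level s∈C s∈D) (on-level t∈C t∈D))
    where
    on-level : ∀ {v} → v ∈ vertices C → v ∈ vertices D → h v ≡ n
    on-level {v} v∈C v∈D with <-cmp (h v) n
    ... | tri< v<n _ _ = ⊥-elim (cycle-not-across D v∈D y∈D v<n n<y)
    ... | tri≈ _ v≡n _ = v≡n
    ... | tri> _ _ n<v = ⊥-elim (cycle-not-across C x∈C v∈C x<n n<v)

module _ {G : Graph} (Q : V G → Set) (h : V G → ℕ)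
         (unit-step : ∀ {x y} → Q x → Q y → E G x y → Adjacent (h x) (h y))
         (h-injective : ∀ {x y} → Q x → Q y → h x ≡ h y → x ≡ y) where

  at-most-two-neighbours : ∀ {x y₁ y₂ y₃} → Q x → Q y₁ → Q y₂ → Q y₃ →
                           E G x y₁ → E G x y₂ → E G x y₃ → y₁ ≡ y₂ ⊎ y₁ ≡ y₃ ⊎ y₂ ≡ y₃
  at-most-two-neighbours qx q₁ q₂ q₃ e₁ e₂ e₃ =
    Sum.map (h-injective q₁ q₂) (Sum.map (h-injective q₁ q₃) (h-injective q₂ q₃))
      (adjacent-pigeonhole (unit-step qx q₁ e₁) (unit-step qx q₂ e₂) (unit-step qx q₃ e₃))

  same-side-neighbours : ∀ {x y y′} → Q x → Q y → Q y′ → E G x y → E G y′ x →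
                         (h y < h x × h y′ < h x) ⊎ (h x < h y × h x < h y′) → y ≡ y′
  same-side-neighbours qx qy qy′ xy y′x (inj₁ (y<x , y′<x)) =
    h-injective qy qy′ (suc-injective (trans (adjacent-below (unit-step qx qy xy) y<x)
                                        (sym (adjacent-above (unit-step qy′ qx y′x) y′<x))))
  same-side-neighbours qx qy qy′ xy y′x (inj₂ (x<y , x<y′)) =
    h-injective qy qy′ (trans (sym (adjacent-above (unit-step qx qy xy) x<y))
                              (adjacent-below (unit-step qy′ qx y′x) x<y′))

  no-long-cycle : (C : Cycle G) → All Q (vertices C) →
                  ∀ {p q} → p ∈ rest C → q ∈ rest C → p ≢ q → ⊥
  no-long-cycle record { start = x ; rest = R ; closed = w ; distinct = d } (qx ∷ qR) p∈ q∈ p≢q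
    with initLast R
  ... | []             = case p∈ of λ ()
  ... | [] ∷ʳ′ _       = p≢q (trans (singleton⁻ p∈) (sym (singleton⁻ q∈)))
  ... | (y ∷ M) ∷ʳ′ yl =
    Unique[x∷xs]⇒x∉xs (drop⁺ 1 d) (subst (_∈ M ++ [ yl ]) (sym y≡yl) (∈-++⁺ʳ M (here refl)))
    where
    yl∈R : yl ∈ R
    yl∈R = ∈-++⁺ʳ (y ∷ M) (here refl)
    R-walk : IsWalk G R
    R-walk = isWalk-++⁻ˡ R (isWalk-∷⁻ (R ++ [ x ]) w)
    yl-x : E G yl x
    yl-x = proj₁ (isWalk-++⁻ʳ (y ∷ M)
             (subst (IsWalk G) (++-assoc (y ∷ M) [ yl ] [ x ]) (isWalk-∷⁻ (R ++ [ x ]) w)))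
    off-level : All (λ v → h v ≢ h x) R
    off-level = All.tabulate λ v∈R v-level →
      Unique[x∷xs]⇒x∉xs d (subst (_∈ R) (h-injective (All.lookup qR v∈R) qx v-level) v∈R)
    y≡yl : y ≡ yl
    y≡yl = same-side-neighbours qx (All.lookup qR (here refl)) (All.lookup qR yl∈R)
             (proj₁ w) yl-x
             (Sum.map (λ below → All.lookup below (here refl) , All.lookup below yl∈R)
                      (λ above → All.lookup above (here refl) , All.lookup above yl∈R)
                      (walk-on-one-side Q h (h x) (λ qa qb → adjacent⇒¬crosses ∘ unit-step qa qb)
                         R-walk qR off-level))

-- Subdivisions

-- A piece of (the image of) a subdivision: the branch vertex of x, or the inner vertices of
-- the path stored for the ordered edge xy.
data Piece (A : Set) : Set where
  node : A → Piece A
  path : A → A → Piece A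

-- The neighbour of a branch vertex c along an edge of H, read off the path stored for cy
-- (outgoing y) or for xc (incoming x), whichever orientation the surrounding faces use.
data Spoke (A : Set) : Set where
  outgoing : A → Spoke A
  incoming : A → Spoke A

module Pieces (H : Graph) where

  Apart : Piece (V H) → Piece (V H) → Set
  Apart (node x)    (node y)    = x ≢ y
  Apart (node _)    (path y y′) = E H y y′
  Apart (path x x′) (node _)    = E H x x′
  Apart (path x x′) (path y y′) = E H x x′ × E H y y′ × ¬ SameEdge x x′ y y′

  Valid : Piece (V H) → Set
  Valid (node _)   = ⊤
  Valid (path x y) = E H x y

  WellFormed : List (Piece (V H)) → Set
  WellFormed ps = AllPairs Apart ps × All Valid ps

  legs : V H → List (V H) → V H → List (Piece (V H))
  legs x []       f = path x f ∷ []
  legs x (y ∷ ys) f = path x y ∷ node y ∷ legs y ys f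

  cyclePieces : V H → List (V H) → List (Piece (V H))
  cyclePieces v vs = node v ∷ legs v vs v

  AllAcross : (Piece (V H) → Piece (V H) → Set) → (ps qs : List (Piece (V H))) → Set
  AllAcross R ps qs = All (λ p → All (R p) qs) ps

  Separated : List (Piece (V H)) → List (Piece (V H)) → Set
  Separated = AllAcross Apart

  MeetOnlyAt : V H → List (Piece (V H)) → List (Piece (V H)) → Set
  MeetOnlyAt x = AllAcross (λ p q → Apart p q ⊎ (p ≡ node x × q ≡ node x))

  SharesNodes : V H → V H → List (Piece (V H)) → List (Piece (V H)) → Set
  SharesNodes s t ps qs = s ≢ t × (node s ∈ ps × node s ∈ qs) × (node t ∈ ps × node t ∈ qs)

  CoveredBy : {I : Set} → (I → List (Piece (V H))) → List (Piece (V H)) → Set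
  CoveredBy F ps = All (λ p → ∃[ i ] p ∈ F i) ps

  spokePieces : V H → Spoke (V H) → List (Piece (V H))
  spokePieces c (outgoing y) = path c y ∷ node y ∷ []
  spokePieces c (incoming x) = node x ∷ path x c ∷ []

  SpokeEdge : V H → Spoke (V H) → Set
  SpokeEdge c (outgoing y) = E H c y
  SpokeEdge c (incoming x) = E H x c

  record Star : Set where
    constructor star
    field
      centre   : V H
      s₁ s₂ s₃ : Spoke (V H)

  starPieces : Star → List (Piece (V H))
  starPieces (star c s₁ s₂ s₃) =
    node c ∷ spokePieces c s₁ ++ spokePieces c s₂ ++ spokePieces c s₃

  IsStar : Star → Set
  IsStar (star c s₁ s₂ s₃) = (SpokeEdge c s₁ × SpokeEdge c s₂ × SpokeEdge c s₃) ×
    Separated (spokePieces c s₁) (spokePieces c s₂) ×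
    Separated (spokePieces c s₁) (spokePieces c s₃) ×
    Separated (spokePieces c s₂) (spokePieces c s₃)

sameEdge? : {A : Set} → DecidableEquality A → ∀ (x y x′ y′ : A) → Dec (SameEdge x y x′ y′)
sameEdge? _≟_ x y x′ y′ = (x ≟ x′ ×-dec y ≟ y′) ⊎-dec (x ≟ y′ ×-dec y ≟ x′)

module DecidablePieces (H : Graph) (_≟ᴴ_ : DecidableEquality (V H))
                       (adj? : ∀ x y → Dec (E H x y)) where
  open Pieces H

  _≟ₚ_ : DecidableEquality (Piece (V H))
  node x    ≟ₚ node y    = map′ (cong node) (λ { refl → refl }) (x ≟ᴴ y)
  node _    ≟ₚ path _ _  = no λ ()
  path _ _  ≟ₚ node _    = no λ ()
  path x x′ ≟ₚ path y y′ =
    map′ (λ (x≡y , x′≡y′) → cong₂ path x≡y x′≡y′) (λ { refl → refl , refl })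
         (x ≟ᴴ y ×-dec x′ ≟ᴴ y′)

  open DecMembership _≟ₚ_ public using (_∈?_)

  apart? : ∀ p q → Dec (Apart p q)
  apart? (node x)    (node y)    = ¬? (x ≟ᴴ y)
  apart? (node _)    (path y y′) = adj? y y′
  apart? (path x x′) (node _)    = adj? x x′
  apart? (path x x′) (path y y′) = adj? x x′ ×-dec adj? y y′ ×-dec ¬? (sameEdge? _≟ᴴ_ x x′ y y′)

  valid? : ∀ p → Dec (Valid p)
  valid? (node _)   = yes tt
  valid? (path x y) = adj? x y

  wellFormed? : ∀ ps → Dec (WellFormed ps)
  wellFormed? ps = allPairs? apart? ps ×-dec All.all? valid? ps

  allAcross? : ∀ {R} → (∀ p q → Dec (R p q)) → ∀ ps qs → Dec (AllAcross R ps qs)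
  allAcross? R? ps qs = All.all? (λ p → All.all? (R? p) qs) ps

  separated? : ∀ ps qs → Dec (Separated ps qs)
  separated? = allAcross? apart?

  meetOnlyAt? : ∀ x ps qs → Dec (MeetOnlyAt x ps qs)
  meetOnlyAt? x = allAcross? λ p q → apart? p q ⊎-dec (p ≟ₚ node x ×-dec q ≟ₚ node x)

  sharesNodes? : ∀ s t ps qs → Dec (SharesNodes s t ps qs)
  sharesNodes? s t ps qs =
    ¬? (s ≟ᴴ t) ×-dec (node s ∈? ps ×-dec node s ∈? qs) ×-dec (node t ∈? ps ×-dec node t ∈? qs)

  coveredBy? : ∀ {n} (F : Fin n → List (Piece (V H))) ps → Dec (CoveredBy F ps)
  coveredBy? F = All.all? λ p → Finₚ.any? λ i → p ∈? F i

  spokeEdge? : ∀ c s → Dec (SpokeEdge c s)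
  spokeEdge? c (outgoing y) = adj? c y
  spokeEdge? c (incoming x) = adj? x c

  isStar? : ∀ σ → Dec (IsStar σ)
  isStar? (star c s₁ s₂ s₃) =
    (spokeEdge? c s₁ ×-dec spokeEdge? c s₂ ×-dec spokeEdge? c s₃) ×-dec
    separated? (spokePieces c s₁) (spokePieces c s₂) ×-dec
    separated? (spokePieces c s₁) (spokePieces c s₃) ×-dec
    separated? (spokePieces c s₂) (spokePieces c s₃)

module Realisation {H G : Graph} (S : SubdivisionIn H G) where
  open SubdivisionIn S
  open Pieces H

  ⟦_⟧ : Piece (V H) → List (V G)
  ⟦ node x ⟧   = [ branch x ]
  ⟦ path x y ⟧ = inner x y

  ⟦_⟧* : List (Piece (V H)) → List (V G)
  ⟦ []     ⟧* = []
  ⟦ p ∷ ps ⟧* = ⟦ p ⟧ ++ ⟦ ps ⟧*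

  ∈-⟦⟧*⁺ : ∀ {p ps v} → p ∈ ps → v ∈ ⟦ p ⟧ → v ∈ ⟦ ps ⟧*
  ∈-⟦⟧*⁺ {ps = _ ∷ _} (here refl) v∈p = ∈-++⁺ˡ v∈p
  ∈-⟦⟧*⁺ {ps = p ∷ _} (there p∈)  v∈p = ∈-++⁺ʳ ⟦ p ⟧ (∈-⟦⟧*⁺ p∈ v∈p)

  ∈-⟦⟧*⁻ : ∀ ps {v} → v ∈ ⟦ ps ⟧* → ∃[ p ] p ∈ ps × v ∈ ⟦ p ⟧
  ∈-⟦⟧*⁻ (p ∷ ps) v∈ with ∈-++⁻ ⟦ p ⟧ v∈
  ... | inj₁ v∈p  = p , here refl , v∈p
  ... | inj₂ v∈ps = let q , q∈ , v∈q = ∈-⟦⟧*⁻ ps v∈ps in q , there q∈ , v∈q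

  ⟦⟧*-mono : ∀ {ps qs} → ps ⊆ qs → ⟦ ps ⟧* ⊆ ⟦ qs ⟧*
  ⟦⟧*-mono {ps} ps⊆qs v∈ = let p , p∈ , v∈p = ∈-⟦⟧*⁻ ps v∈ in ∈-⟦⟧*⁺ (ps⊆qs p∈) v∈p

  apart-disjoint : ∀ p q {v} → Apart p q → v ∈ ⟦ p ⟧ → v ∈ ⟦ q ⟧ → ⊥
  apart-disjoint (node x)    (node y)    x≢y (here refl) (here eq) = x≢y (branch-inj x y eq)
  apart-disjoint (node x)    (path y y′) yy′ (here refl) v∈ = inner-nobranch y y′ yy′ _ v∈ x refl
  apart-disjoint (path x x′) (node y)    xx′ v∈ (here refl) = inner-nobranch x x′ xx′ _ v∈ y refl
  apart-disjoint (path x x′) (path y y′) (xx′ , yy′ , ¬same) v∈ v∈′ =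
    inner-disjoint x x′ y y′ xx′ yy′ ¬same _ v∈ v∈′

  all-across : ∀ {R} {T : V G → Set} → (∀ p q {v} → R p q → v ∈ ⟦ p ⟧ → v ∈ ⟦ q ⟧ → T v) →
               ∀ {ps qs v} → AllAcross R ps qs → v ∈ ⟦ ps ⟧* → v ∈ ⟦ qs ⟧* → T v
  all-across sound {ps} {qs} across v∈ps v∈qs =
    let p , p∈ , v∈p = ∈-⟦⟧*⁻ ps v∈ps
        q , q∈ , v∈q = ∈-⟦⟧*⁻ qs v∈qs
    in sound p q (All.lookup (All.lookup across p∈) q∈) v∈p v∈q

  separated-disjoint : ∀ {ps qs v} → Separated ps qs → v ∈ ⟦ ps ⟧* → v ∈ ⟦ qs ⟧* → ⊥
  separated-disjoint = all-across apart-disjoint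

  meet-only-at : ∀ {x ps qs v} → MeetOnlyAt x ps qs → v ∈ ⟦ ps ⟧* → v ∈ ⟦ qs ⟧* → v ≡ branch x
  meet-only-at = all-across λ where
    p q (inj₁ apart)      v∈p        v∈q → ⊥-elim (apart-disjoint p q apart v∈p v∈q)
    _ _ (inj₂ (refl , _)) (here v≡x) _   → v≡x

  ⟦⟧*-unique : ∀ {ps} → WellFormed ps → Unique ⟦ ps ⟧*
  ⟦⟧*-unique {[]}     ([] , [])                          = []
  ⟦⟧*-unique {p ∷ ps} ((apart ∷ apartness) , (valid ∷ vs)) =
    ++⁺ (piece-unique p valid) (⟦⟧*-unique (apartness , vs))
        (λ (v∈p , v∈ps) → separated-disjoint {p ∷ []} (apart ∷ []) (∈-++⁺ˡ v∈p) v∈ps)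
    where
    piece-unique : ∀ p → Valid p → Unique ⟦ p ⟧
    piece-unique (node _)   _  = [] ∷ []
    piece-unique (path x y) xy = inner-unique x y xy

  legs-walk : ∀ x ys f → All Valid (legs x ys f) →
              IsWalk G (branch x ∷ ⟦ legs x ys f ⟧* ++ [ branch f ])
  legs-walk x [] f (xf ∷ []) =
    subst (λ l → IsWalk G (branch x ∷ l ++ [ branch f ])) (sym (++-identityʳ (inner x f)))
      (inner-walk x f xf)
  legs-walk x (y ∷ ys) f (xy ∷ _ ∷ valid) =
    subst (λ l → IsWalk G (branch x ∷ l)) (sym (++-assoc (inner x y) _ [ branch f ]))
      (isWalk-++⁺ (branch x ∷ inner x y) (inner-walk x y xy) (legs-walk y ys f valid))

  cycleOf : ∀ v vs → WellFormed (cyclePieces v vs) → Cycle G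
  cycleOf v vs wf = record
    { start    = branch v
    ; rest     = ⟦ legs v vs v ⟧*
    ; closed   = legs-walk v vs v (All.tail (proj₂ wf))
    ; distinct = ⟦⟧*-unique wf
    }

  shared-nodes-linked : ∀ {s t ps qs} → SharesNodes s t ps qs →
    ∃₂ λ a b → a ≢ b × (a ∈ ⟦ ps ⟧* × a ∈ ⟦ qs ⟧*) × (b ∈ ⟦ ps ⟧* × b ∈ ⟦ qs ⟧*)
  shared-nodes-linked {s} {t} (s≢t , (s∈ps , s∈qs) , (t∈ps , t∈qs)) =
    branch s , branch t , s≢t ∘ branch-inj s t ,
    (∈-⟦⟧*⁺ s∈ps (here refl) , ∈-⟦⟧*⁺ s∈qs (here refl)) ,
    (∈-⟦⟧*⁺ t∈ps (here refl) , ∈-⟦⟧*⁺ t∈qs (here refl))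

  covered-∈ : ∀ {I : Set} {F : I → List (Piece (V H))} {ps v} → CoveredBy F ps →
              v ∈ ⟦ ps ⟧* → ∃[ i ] v ∈ ⟦ F i ⟧*
  covered-∈ {ps = ps} covered v∈ =
    let p , p∈ , v∈p = ∈-⟦⟧*⁻ ps v∈
        i , p∈Fi     = All.lookup covered p∈
    in i , ∈-⟦⟧*⁺ p∈Fi v∈p

  spokeVertex : V H → Spoke (V H) → V G
  spokeVertex c (outgoing y) = headOr (inner c y) (branch y)
  spokeVertex c (incoming x) = lastOr (inner x c) (branch x)

  spoke-∈ : ∀ c s → spokeVertex c s ∈ ⟦ spokePieces c s ⟧*
  spoke-∈ c (outgoing y) = headOr-∈ (inner c y)
  spoke-∈ c (incoming x) =
    subst (λ l → lastOr (inner x c) (branch x) ∈ branch x ∷ l) (sym (++-identityʳ (inner x c)))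
      (lastOr-∈ (inner x c))

  spoke-edge : (∀ {x y} → E G x y → E G y x) →
               ∀ c s → SpokeEdge c s → E G (branch c) (spokeVertex c s)
  spoke-edge _    c (outgoing y) cy = isWalk-first-edge (inner c y) (inner-walk c y cy)
  spoke-edge flip c (incoming x) xc = flip (isWalk-last-edge (inner x c) (inner-walk x c xc))

  separated-spokes-differ : ∀ c s s′ → Separated (spokePieces c s) (spokePieces c s′) →
                            spokeVertex c s ≢ spokeVertex c s′
  separated-spokes-differ c s s′ separated eq =
    separated-disjoint separated (spoke-∈ c s)
      (subst (_∈ ⟦ spokePieces c s′ ⟧*) (sym eq) (spoke-∈ c s′))

  star-∈ : ∀ c s₁ s₂ s₃ {w} →
           w ∈ branch c ∷ spokeVertex c s₁ ∷ spokeVertex c s₂ ∷ spokeVertex c s₃ ∷ [] →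
           w ∈ ⟦ starPieces (star c s₁ s₂ s₃) ⟧*
  star-∈ c s₁ s₂ s₃ (here refl) = here refl
  star-∈ c s₁ s₂ s₃ (there (here refl)) =
    there (⟦⟧*-mono (xs⊆xs++ys (spokePieces c s₁) _) (spoke-∈ c s₁))
  star-∈ c s₁ s₂ s₃ (there (there (here refl))) =
    there (⟦⟧*-mono (xs⊆ys++xs _ (spokePieces c s₁) ∘ xs⊆xs++ys _ (spokePieces c s₃))
                    (spoke-∈ c s₂))
  star-∈ c s₁ s₂ s₃ (there (there (there (here refl)))) =
    there (⟦⟧*-mono (xs⊆ys++xs _ (spokePieces c s₁) ∘ xs⊆ys++xs _ (spokePieces c s₂))
                    (spoke-∈ c s₃))

-- The condensed wall

module Wall (r : ℕ) where

  Vtx : Set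
  Vtx = V (W-ab r)

  zAt : Fin (suc r) → Vtx
  zAt i = z i , tt

  IsZ : Vtx → Set
  IsZ v = ∃[ i ] v ≡ zAt i

  isZ? : (v : Vtx) → Dec (IsZ v)
  isZ? (z i   , _) = yes (i , refl)
  isZ? (u _ _ , _) = no λ { (_ , ()) }

  level : Vtx → ℕ
  level (u j _ , _) = suc (2 * toℕ j)
  level (z i   , _) = 2 * toℕ i

  private
    edge-no-crossing : ∀ m {x y : Vtx} → WEdge r (proj₁ x) (proj₁ y) →
                       ¬ Crosses (2 * m) (level x) (level y)
    edge-no-crossing m {u _ _ , _} {u _ _ , _} (uu _ _ _ _) (inj₁ (p<n , n<p)) = <-asym p<n n<p
    edge-no-crossing m {u _ _ , _} {u _ _ , _} (uu _ _ _ _) (inj₂ (p<n , n<p)) = <-asym p<n n<p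
    edge-no-crossing m {z _ , _} {u _ _ , _} (zuo _ _ _ i≡j _) =
      adjacent⇒¬crosses (inj₁ (cong (λ t → suc (2 * t)) i≡j))
    edge-no-crossing m {z _ , _} {u j _ , _} (zue _ _ _ i≡1+j _) =
      adjacent⇒¬crosses (inj₂ (trans (sym (*-suc 2 (toℕ j))) (cong (2 *_) (sym i≡1+j))))
    edge-no-crossing m {z i , _} {z i′ , _} (zz _ _ i′≡1+i) (inj₁ (p<n , n<q)) =
      ¬between-successive (*-cancelˡ-< 2 (toℕ i) m p<n)
        (subst (m <_) i′≡1+i (*-cancelˡ-< 2 m (toℕ i′) n<q))
    edge-no-crossing m {z i , _} {z i′ , _} (zz _ _ i′≡1+i) (inj₂ (q<n , n<p)) =
      <-asym (<-trans (subst (toℕ i <_) (sym i′≡1+i) (n<1+n _)) (*-cancelˡ-< 2 (toℕ i′) m q<n))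
             (*-cancelˡ-< 2 m (toℕ i) n<p)

  level-no-crossing : ∀ m {x y : Vtx} → E (W-ab r) x y → ¬ Crosses (2 * m) (level x) (level y)
  level-no-crossing m (inj₁ e) = edge-no-crossing m e
  level-no-crossing m (inj₂ e) = edge-no-crossing m e ∘ Sum.swap

  on-even-level : ∀ {m} (x : Vtx) → level x ≡ 2 * m → ∃[ i ] toℕ i ≡ m × x ≡ zAt i
  on-even-level {m} (u j _ , _) odd≡even = ⊥-elim (even≢odd m (toℕ j) (sym odd≡even))
  on-even-level {m} (z i   , _) i-level  = i , *-cancelˡ-≡ (toℕ i) m 2 i-level , refl

  level-unique : ∀ {m} {x y : Vtx} → level x ≡ 2 * m → level y ≡ 2 * m → x ≡ y
  level-unique {m} {x} {y} x-level y-level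
    with on-even-level {m} x x-level | on-even-level {m} y y-level
  ... | i , i≡m , refl | j , j≡m , refl = cong zAt (toℕ-injective (trans i≡m (sym j≡m)))

  -- Row by row, so that consecutive vertices of a row are consecutive numbers.
  position : Vtx → ℕ
  position (u j k , _) = toℕ (combine j k)
  position (z _   , _) = 0

  private
    position-suc : ∀ (j : Fin r) {k k′ : Fin (2 * r)} → toℕ k′ ≡ suc (toℕ k) →
                   suc (toℕ (combine j k)) ≡ toℕ (combine j k′)
    position-suc j {k} {k′} k′≡1+k = begin
      suc (toℕ (combine j k))     ≡⟨ cong suc (toℕ-combine j k) ⟩
      suc (2 * r * toℕ j + toℕ k) ≡⟨ +-suc (2 * r * toℕ j) (toℕ k) ⟨
      2 * r * toℕ j + suc (toℕ k) ≡⟨ cong (2 * r * toℕ j +_) k′≡1+k ⟨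
      2 * r * toℕ j + toℕ k′      ≡⟨ toℕ-combine j k′ ⟨
      toℕ (combine j k′)          ∎
      where open ≡-Reasoning

  position-unit-step : ∀ {x y : Vtx} → ¬ IsZ x → ¬ IsZ y → E (W-ab r) x y →
                       Adjacent (position x) (position y)
  position-unit-step {z i , _} ¬zx _ _ = ⊥-elim (¬zx (i , refl))
  position-unit-step {_} {z i , _} _ ¬zy _ = ⊥-elim (¬zy (i , refl))
  position-unit-step {u j _ , _} {u _ _ , _} _ _ (inj₁ (uu _ _ _ k′≡1+k)) =
    inj₁ (position-suc j k′≡1+k)
  position-unit-step {u _ _ , _} {u j _ , _} _ _ (inj₂ (uu _ _ _ k′≡1+k)) =
    inj₂ (position-suc j k′≡1+k)

  position-injective : ∀ {x y : Vtx} → ¬ IsZ x → ¬ IsZ y → position x ≡ position y → x ≡ y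
  position-injective {z i , _} ¬zx _ _ = ⊥-elim (¬zx (i , refl))
  position-injective {_} {z i , _} _ ¬zy _ = ⊥-elim (¬zy (i , refl))
  position-injective {u j k , _} {u j′ k′ , _} _ _ eq
    with combine-injectiveˡ j k j′ k′ (toℕ-injective eq)
       | combine-injectiveʳ j k j′ k′ (toℕ-injective eq)
  ... | refl | refl = refl

  cycle-has-z : (C : Cycle (W-ab r)) → ∀ {p q} → p ∈ rest C → q ∈ rest C → p ≢ q →
                ∃[ v ] v ∈ vertices C × IsZ v
  cycle-has-z C p∈ q∈ p≢q with any? isZ? (vertices C)
  ... | yes some = find some
  ... | no none  = ⊥-elim (no-long-cycle (¬_ ∘ IsZ) position position-unit-step
                             position-injective C (¬Any⇒All¬ _ none) p∈ q∈ p≢q)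

  z-among-three-neighbours : ∀ {c n₁ n₂ n₃ : Vtx} →
    E (W-ab r) c n₁ → E (W-ab r) c n₂ → E (W-ab r) c n₃ → n₁ ≢ n₂ → n₁ ≢ n₃ → n₂ ≢ n₃ →
    ∃[ w ] w ∈ c ∷ n₁ ∷ n₂ ∷ n₃ ∷ [] × IsZ w
  z-among-three-neighbours e₁ e₂ e₃ n₁≢n₂ n₁≢n₃ n₂≢n₃ with any? isZ? (_ ∷ _ ∷ _ ∷ _ ∷ [])
  ... | yes some = find some
  ... | no none with ¬Any⇒All¬ _ none
  ...   | ¬zc ∷ ¬z₁ ∷ ¬z₂ ∷ ¬z₃ ∷ [] = ⊥-elim ([ n₁≢n₂ , [ n₁≢n₃ , n₂≢n₃ ]′ ]′
    (at-most-two-neighbours (¬_ ∘ IsZ) position position-unit-step position-injective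
       ¬zc ¬z₁ ¬z₂ ¬z₃ e₁ e₂ e₃))

  linked-z-close : (C D : Cycle (W-ab r)) → Linked C D → ∀ {i k} →
                   zAt i ∈ vertices C → zAt k ∈ vertices D → toℕ k ≤ suc (toℕ i)
  linked-z-close C D linked {i} {k} i∈C k∈D with toℕ k ≤? suc (toℕ i)
  ... | yes k≤1+i = k≤1+i
  ... | no  k≰1+i =
    ⊥-elim (linked-not-across level (2 * suc (toℕ i)) (level-no-crossing (suc (toℕ i)))
              (level-unique {suc (toℕ i)}) C D linked i∈C k∈D
              (*-monoʳ-< 2 (n<1+n (toℕ i))) (*-monoʳ-< 2 (≰⇒> k≰1+i)))

  module _ {I : Set} (C : I → Cycle (W-ab r)) (linked : ∀ f g → Linked (C f) (C g)) where

    OnCycles : Vtx → Set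
    OnCycles v = ∃[ f ] v ∈ vertices (C f)

    at-most-two-z : ∀ {p q s} → OnCycles p → OnCycles q → OnCycles s →
                    IsZ p → IsZ q → IsZ s → p ≡ q ⊎ q ≡ s ⊎ p ≡ s
    at-most-two-z (_ , p∈) (_ , q∈) (_ , s∈) (_ , refl) (_ , refl) (_ , refl) =
      Sum.map same (Sum.map same same) (within-one-pigeonhole
        (close p∈ q∈) (close q∈ p∈) (close q∈ s∈) (close s∈ q∈) (close p∈ s∈) (close s∈ p∈))
      where
      close : ∀ {f g i k} → zAt i ∈ vertices (C f) → zAt k ∈ vertices (C g) →
              toℕ k ≤ suc (toℕ i)
      close {f} {g} = linked-z-close (C f) (C g) (linked f g)
      same : ∀ {i j} → toℕ i ≡ toℕ j → zAt i ≡ zAt j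
      same i≡j = cong zAt (toℕ-injective i≡j)

-- The elementary B₄

b4Adj? : ∀ x y → Dec (B4Adj x y)
b4Adj? x y = Finₚ.any? λ c → Finₚ.any? λ i →
  sameEdge? Finₚ._≟_ (lookup (cell c) i) (lookup (cell c) (next6 i)) x y

open Pieces B4
open DecidablePieces B4 Finₚ._≟_ b4Adj?

-- Face 0 is the boundary of the union of the four cells, faces 1 and 2 are the cells X, Y.
boundary : Fin 3 → Fin 16 × List (Fin 16)
boundary zero             =
  # 2 , # 3 ∷ # 4 ∷ # 5 ∷ # 15 ∷ # 14 ∷ # 13 ∷ # 9 ∷ # 8 ∷ # 7 ∷ # 6 ∷ # 10 ∷ # 11 ∷ # 12 ∷ []
boundary (suc zero)       = # 1 , # 2 ∷ # 3 ∷ # 4 ∷ # 5 ∷ # 0 ∷ []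
boundary (suc (suc zero)) = # 1 , # 6 ∷ # 7 ∷ # 8 ∷ # 9 ∷ # 0 ∷ []

outer : Fin 3
outer = zero

facePieces : Fin 3 → List (Piece (Fin 16))
facePieces f = cyclePieces (proj₁ (boundary f)) (proj₂ (boundary f))

faces-well-formed : ∀ f → WellFormed (facePieces f)
faces-well-formed = from-yes (Finₚ.all? λ f → wellFormed? (facePieces f))

sharedNodes : Fin 3 → Fin 3 → Fin 16 × Fin 16
sharedNodes zero             (suc (suc zero)) = # 6 , # 7
sharedNodes (suc (suc zero)) zero             = # 6 , # 7
sharedNodes zero             _                = # 2 , # 3
sharedNodes (suc zero)       zero             = # 2 , # 3
sharedNodes _                _                = # 0 , # 1

faces-share-nodes : ∀ f g → let s , t = sharedNodes f g in
                    SharesNodes s t (facePieces f) (facePieces g)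
faces-share-nodes = from-yes (Finₚ.all? λ f → Finₚ.all? λ g →
  sharesNodes? (proj₁ (sharedNodes f g)) (proj₂ (sharedNodes f g)) (facePieces f) (facePieces g))

star₂ star₆ star₅ star₉ : Star
star₂ = star (# 2) (outgoing (# 3))  (incoming (# 12)) (incoming (# 1))
star₆ = star (# 6) (outgoing (# 10)) (incoming (# 7))  (incoming (# 1))
star₅ = star (# 5) (outgoing (# 15)) (incoming (# 4))  (outgoing (# 0))
star₉ = star (# 9) (outgoing (# 8))  (incoming (# 13)) (outgoing (# 0))

IsStarOnFaces : Star → Set
IsStarOnFaces σ = IsStar σ × CoveredBy facePieces (starPieces σ)

isStarOnFaces? : ∀ σ → Dec (IsStarOnFaces σ)
isStarOnFaces? σ = isStar? σ ×-dec coveredBy? facePieces (starPieces σ)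

star₂-on-faces : IsStarOnFaces star₂
star₂-on-faces = from-yes (isStarOnFaces? star₂)

star₆-on-faces : IsStarOnFaces star₆
star₆-on-faces = from-yes (isStarOnFaces? star₆)

star₅-on-faces : IsStarOnFaces star₅
star₅-on-faces = from-yes (isStarOnFaces? star₅)

star₉-on-faces : IsStarOnFaces star₉
star₉-on-faces = from-yes (isStarOnFaces? star₉)

star₂∣star₅ : Separated (starPieces star₂) (starPieces star₅)
star₂∣star₅ = from-yes (separated? (starPieces star₂) (starPieces star₅))

star₅∣star₂ : Separated (starPieces star₅) (starPieces star₂)
star₅∣star₂ = from-yes (separated? (starPieces star₅) (starPieces star₂))

star₆∣star₅ : Separated (starPieces star₆) (starPieces star₅)
star₆∣star₅ = from-yes (separated? (starPieces star₆) (starPieces star₅))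

star₉∣star₂ : Separated (starPieces star₉) (starPieces star₂)
star₉∣star₂ = from-yes (separated? (starPieces star₉) (starPieces star₂))

star₂-meets-star₆-at-1 : MeetOnlyAt (# 1) (starPieces star₂) (starPieces star₆)
star₂-meets-star₆-at-1 = from-yes (meetOnlyAt? (# 1) (starPieces star₂) (starPieces star₆))

star₅-meets-star₉-at-0 : MeetOnlyAt (# 0) (starPieces star₅) (starPieces star₉)
star₅-meets-star₉-at-0 = from-yes (meetOnlyAt? (# 0) (starPieces star₅) (starPieces star₉))

outer-avoids-0-1 : Separated (node (# 0) ∷ node (# 1) ∷ []) (facePieces outer)
outer-avoids-0-1 = from-yes (separated? (node (# 0) ∷ node (# 1) ∷ []) (facePieces outer))

outer-passes-3-4 : node (# 3) ∈ legs (# 2) (proj₂ (boundary outer)) (# 2) ×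
                   node (# 4) ∈ legs (# 2) (proj₂ (boundary outer)) (# 2)
outer-passes-3-4 = from-yes (node (# 3) ∈? legs (# 2) (proj₂ (boundary outer)) (# 2) ×-dec
                             node (# 4) ∈? legs (# 2) (proj₂ (boundary outer)) (# 2))

-- B₄ in the wall

module InWall (r : ℕ) (S : SubdivisionIn B4 (W-ab r)) where
  open Wall r
  open SubdivisionIn S
  open Realisation S

  face : Fin 3 → Cycle (W-ab r)
  face f = cycleOf (proj₁ (boundary f)) (proj₂ (boundary f)) (faces-well-formed f)

  faces-linked : ∀ f g → Linked (face f) (face g)
  faces-linked f g = shared-nodes-linked (faces-share-nodes f g)

  record Hub (σ : Star) : Set where
    field
      vertex   : Vtx
      in-star  : vertex ∈ ⟦ starPieces σ ⟧*
      on-faces : OnCycles face faces-linked vertex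
      is-z     : IsZ vertex

  hub : ∀ σ → IsStarOnFaces σ → Hub σ
  hub σ@(star c s₁ s₂ s₃) (((e₁ , e₂ , e₃) , s₁∣s₂ , s₁∣s₃ , s₂∣s₃) , covered)
    with z-among-three-neighbours (edge s₁ e₁) (edge s₂ e₂) (edge s₃ e₃)
           (separated-spokes-differ c s₁ s₂ s₁∣s₂) (separated-spokes-differ c s₁ s₃ s₁∣s₃)
           (separated-spokes-differ c s₂ s₃ s₂∣s₃)
    where
    edge : ∀ s → SpokeEdge c s → E (W-ab r) (branch c) (spokeVertex c s)
    edge = spoke-edge Sum.swap c
  ... | w , w∈ , w-z = record
    { vertex = w ; in-star = w∈σ ; on-faces = covered-∈ covered w∈σ ; is-z = w-z }
    where
    w∈σ : w ∈ ⟦ starPieces σ ⟧*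
    w∈σ = star-∈ c s₁ s₂ s₃ w∈

  hubs-differ : ∀ {σ τ} (p : Hub σ) (q : Hub τ) → Separated (starPieces σ) (starPieces τ) →
                Hub.vertex p ≢ Hub.vertex q
  hubs-differ p q σ∣τ eq =
    separated-disjoint σ∣τ (Hub.in-star p) (subst (_∈ _) (sym eq) (Hub.in-star q))

  hubs-meet : ∀ {x σ τ} (p : Hub σ) (q : Hub τ) → MeetOnlyAt x (starPieces σ) (starPieces τ) →
              Hub.vertex p ≡ Hub.vertex q → Hub.vertex p ≡ branch x
  hubs-meet p q meet eq =
    meet-only-at meet (Hub.in-star p) (subst (_∈ _) (sym eq) (Hub.in-star q))

  hubs-coincide : ∀ {σ τ υ} (p : Hub σ) (q : Hub τ) (s : Hub υ) →
                  Separated (starPieces τ) (starPieces υ) → Separated (starPieces σ) (starPieces υ) →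
                  Hub.vertex p ≡ Hub.vertex q
  hubs-coincide p q s τ∣υ σ∣υ =
    [ id , [ ⊥-elim ∘ hubs-differ q s τ∣υ , ⊥-elim ∘ hubs-differ p s σ∣υ ]′ ]′
      (at-most-two-z face faces-linked (Hub.on-faces p) (Hub.on-faces q) (Hub.on-faces s)
         (Hub.is-z p) (Hub.is-z q) (Hub.is-z s))

lemma6 : (r : ℕ) → ¬ SubdivisionIn B4 (W-ab r)
lemma6 r S =
  let zₒ , zₒ∈ , zₒ-z = cycle-has-z (face outer) b₃∈ b₄∈ b₃≢b₄
  in [ hubs-differ H₂ H₅ star₂∣star₅
     , [ (λ z₅≡zₒ → off-outer (subst (_∈ _) z₅≡zₒ (here z₅≡b₀)) zₒ∈)
       , (λ z₂≡zₒ → off-outer (subst (_∈ _) z₂≡zₒ (there (here z₂≡b₁))) zₒ∈) ]′ ]′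
     (at-most-two-z face faces-linked (Hub.on-faces H₂) (Hub.on-faces H₅) (outer , zₒ∈)
        (Hub.is-z H₂) (Hub.is-z H₅) zₒ-z)
  where
  open Wall r
  open SubdivisionIn S
  open Realisation S
  open InWall r S

  H₂ : Hub star₂
  H₂ = hub star₂ star₂-on-faces
  H₆ : Hub star₆
  H₆ = hub star₆ star₆-on-faces
  H₅ : Hub star₅
  H₅ = hub star₅ star₅-on-faces
  H₉ : Hub star₉
  H₉ = hub star₉ star₉-on-faces

  z₂≡b₁ : Hub.vertex H₂ ≡ branch (# 1)
  z₂≡b₁ = hubs-meet H₂ H₆ star₂-meets-star₆-at-1 (hubs-coincide H₂ H₆ H₅ star₆∣star₅ star₂∣star₅)

  z₅≡b₀ : Hub.vertex H₅ ≡ branch (# 0)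
  z₅≡b₀ = hubs-meet H₅ H₉ star₅-meets-star₉-at-0 (hubs-coincide H₅ H₉ H₂ star₉∣star₂ star₅∣star₂)

  off-outer : ∀ {v} → v ∈ branch (# 0) ∷ branch (# 1) ∷ [] → v ∉ vertices (face outer)
  off-outer = separated-disjoint {node (# 0) ∷ node (# 1) ∷ []} outer-avoids-0-1

  b₃∈ : branch (# 3) ∈ rest (face outer)
  b₃∈ = ∈-⟦⟧*⁺ (proj₁ outer-passes-3-4) (here refl)

  b₄∈ : branch (# 4) ∈ rest (face outer)
  b₄∈ = ∈-⟦⟧*⁺ (proj₂ outer-passes-3-4) (here refl)

  b₃≢b₄ : branch (# 3) ≢ branch (# 4)
  b₃≢b₄ eq with branch-inj (# 3) (# 4) eq
  ... | ()
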